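{- For a positive integer $d$ define the formal power series in $x_1,\dots,x_d$ \[ A_d(x_1,\dots,x_d)=\sum_{k_1=0}^{\infty}\sum_{k_2=0}^{k_1+1}\cdots\sum_{k_d=0}^{k_{d-1}+1}x_1^{k_1}x_2^{k_2}\cdots x_d^{k_d}. \] Then for all positive integers $d$, \[ A_d(x_1,\dots,x_d)=\frac{\alpha_d(x_1,\dots,x_d)}{\prod_{r=1}^{d}(1-x_1x_2\cdots x_r)}, \] where $\alpha_d(x_1,\dots,x_d)\in\mathbb{Z}[x_1,\dots,x_d]$ is a polynomial of degree $d-1$ in each variable. Moreover, $\alpha_d(0,\dots,0)=1$ and the coefficient of $(x_1\cdots x_d)^{d-1}$ in $\alpha_d$ is $(-1)^{d-1}$. -}

module Defs where

open import Data.Nat as ℕ using (ℕ; zero; suc; _≤ᵇ_; _<ᵇ_)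
open import Data.Integer as ℤ using (ℤ)
open import Data.Bool using (Bool; true; false; if_then_else_; _∧_)
open import Data.List as List using (List; []; _∷_; upTo; concatMap; foldr)
open import Data.Vec as Vec using (Vec; []; _∷_; zipWith; tabulate; replicate)
open import Data.Fin using (Fin; toℕ)
open import Relation.Binary.PropositionalEquality using (_≡_)

Exp : ℕ → Set
Exp d = Vec ℕ d

FPS : ℕ → Set
FPS d = Exp d → ℤ

_≐_ : ∀ {d} → FPS d → FPS d → Set
f ≐ g = ∀ e → f e ≡ g e

_==ᵛ_ : ∀ {d} → Exp d → Exp d → Bool
[] ==ᵛ [] = true
(a ∷ as) ==ᵛ (b ∷ bs) = (a ℕ.≡ᵇ b) ∧ (as ==ᵛ bs)

box : ∀ {d} → Exp d → List (Exp d)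
box [] = [] ∷ []
box (e ∷ es) = concatMap (λ i → List.map (i ∷_) (box es)) (upTo (suc e))

_∸ᵛ_ : ∀ {d} → Exp d → Exp d → Exp d
_∸ᵛ_ = zipWith ℕ._∸_

sumℤ : List ℤ → ℤ
sumℤ = foldr ℤ._+_ (ℤ.+ 0)

_⋆_ : ∀ {d} → FPS d → FPS d → FPS d
(f ⋆ g) e = sumℤ (List.map (λ e' → f e' ℤ.* g (e ∸ᵛ e')) (box e))

_⊝_ : ∀ {d} → FPS d → FPS d → FPS d
(f ⊝ g) e = f e ℤ.- g e

mono : ∀ {d} → Exp d → FPS d
mono m e = if m ==ᵛ e then ℤ.+ 1 else ℤ.+ 0

oneS : ∀ {d} → FPS d
oneS = mono (replicate _ 0)

prefixExp : (d r : ℕ) → Exp d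
prefixExp d r = tabulate (λ i → if toℕ i <ᵇ r then 1 else 0)

denom : (d : ℕ) → FPS d
denom d = foldr _⋆_ oneS (List.map (λ r → oneS ⊝ mono (prefixExp d (suc r))) (upTo d))

adm : ∀ {d} → Exp d → Bool
adm [] = true
adm (k ∷ []) = true
adm (k ∷ k' ∷ ks) = (k' ≤ᵇ suc k) ∧ adm (k' ∷ ks)

A : (d : ℕ) → FPS d
A d k = if adm k then ℤ.+ 1 else ℤ.+ 0

{-# OPTIONS --safe #-}
-- Write p_r for the exponent of x₁⋯x_{r+1} (r < d) and call v admissible when v_{j+1} ≤ v_j + 1 for all j,
-- so that A_d(v) = 1 exactly for admissible v.  Expanding the product ∏_r (1 - x^{p_r}) gives, by
-- inclusion–exclusion,
--   α(k) = Σ_{S ⊆ {0,…,d-1}} (-1)^{|S|} A_d(k - Σ_{r∈S} p_r),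
-- a term being 0 when k - Σ_S p has a negative entry.
-- If some k_j ≥ d, choose i < d with k_i ≥ d and k_{i+1} ≤ k_i.  For S ∌ i the vector v = k - Σ_S p has
-- v_i ≥ i + 1 and v_{i+1} ≤ v_i, and then v is admissible iff v - p_i is; so the terms of S and S ∪ {i}
-- cancel and α(k) = 0.  At k = 0 only S = ∅ contributes.  At k = (d-1,…,d-1) the difference k - Σ_S p
-- is nonnegative and admissible for every S except the full one, for which Σ_S p has first entry d; hence
-- α(k) = 0 - (-1)^d = (-1)^{d-1}, and α reaches degree d - 1 in every variable.
module Submission where

open import Defs
open import Data.Nat using (ℕ; _≤_; _∸_)
open import Data.Integer using (ℤ; +_; -_; _^_)
open import Data.Vec using (lookup; replicate)
open import Data.Vec.Relation.Unary.All using (All)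
open import Data.Fin using (Fin)
open import Data.Product using (Σ; _×_)
open import Relation.Binary.PropositionalEquality using (_≡_; _≢_)

open import Data.Nat as ℕ using (zero; suc; _+_; _<_; z≤n; s≤s; _≤?_; _≟_)
import Data.Nat.Properties as ℕ
open import Data.Nat.ListAction using (sum)
open import Data.Integer using () renaming (_+_ to _+ᶻ_; _*_ to _*ᶻ_; _-_ to _-ᶻ_)
import Data.Integer.Properties as ℤ
open import Data.Integer.Tactic.RingSolver using (solve-∀)
open import Algebra.Properties.CommutativeSemigroup ℕ.+-commutativeSemigroup using (x∙yz≈y∙xz; interchange)
open import Data.Bool using (true; false; if_then_else_; _∧_; T)
open import Data.Bool.Properties using (T-∧)
open import Data.List as List using (List; []; _∷_; _++_; applyUpTo; upTo)
import Data.List.Properties as List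
open import Data.List.Relation.Unary.All as ListAll using ([]; _∷_)
import Data.List.Relation.Unary.All.Properties as ListAll
open import Data.Vec as Vec using (Vec; []; _∷_)
open import Data.Vec.Properties using (lookup-replicate)
open import Data.Vec.Relation.Unary.All using ([]; _∷_)
open import Data.Vec.Relation.Binary.Pointwise.Inductive as Pointwise using (Pointwise; []; _∷_)
open import Data.Product using (_,_; proj₁; proj₂)
open import Data.Sum using (_⊎_; inj₁; inj₂)
open import Function using (_∘_; _⇔_; mk⇔; Equivalence)
open import Relation.Binary.Definitions using (tri<; tri≈; tri>)
open import Relation.Binary.PropositionalEquality
  using (refl; sym; trans; cong; cong₂; subst; subst₂; module ≡-Reasoning)
open import Relation.Nullary using (Dec; yes; no; does; ¬_; contradiction; _×-dec_; T?)
import Relation.Nullary.Decidable as Dec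

private variable
  P Q : Set
  d : ℕ

when : Dec P → ℤ → ℤ
when P? z = if does P? then z else + 0

when-yes : (P? : Dec P) {z : ℤ} → P → when P? z ≡ z
when-yes (yes _) _ = refl
when-yes (no ¬p) p = contradiction p ¬p

when-no : (P? : Dec P) {z : ℤ} → ¬ P → when P? z ≡ + 0
when-no (yes p) ¬p = contradiction p ¬p
when-no (no _) _ = refl

when-⇔ : (P? : Dec P) (Q? : Dec Q) {z : ℤ} → P ⇔ Q → when P? z ≡ when Q? z
when-⇔ (yes p) Q? P⇔Q = sym (when-yes Q? (Equivalence.to P⇔Q p))
when-⇔ (no ¬p) Q? P⇔Q = sym (when-no Q? (¬p ∘ Equivalence.from P⇔Q))

when-× : (P? : Dec P) (Q? : Dec Q) {z : ℤ} → when P? (when Q? z) ≡ when (P? ×-dec Q?) z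
when-× (yes _) Q? = refl
when-× (no _) Q? = refl

when-0 : (P? : Dec P) → when P? (+ 0) ≡ + 0
when-0 (yes _) = refl
when-0 (no _) = refl

when-*ˡ : (P? : Dec P) (y z : ℤ) → when P? y *ᶻ z ≡ when P? (y *ᶻ z)
when-*ˡ (yes _) y z = refl
when-*ˡ (no _) y z = ℤ.*-zeroˡ z

when-*ʳ : (P? : Dec P) (y z : ℤ) → y *ᶻ when P? z ≡ when P? (y *ᶻ z)
when-*ʳ (yes _) y z = refl
when-*ʳ (no _) y z = ℤ.*-zeroʳ y

when-+ : (P? : Dec P) (y z : ℤ) → when P? y +ᶻ when P? z ≡ when P? (y +ᶻ z)
when-+ (yes _) y z = refl
when-+ (no _) y z = refl

when-- : (P? : Dec P) (y z : ℤ) → when P? y -ᶻ when P? z ≡ when P? (y -ᶻ z)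
when-- (yes _) y z = refl
when-- (no _) y z = refl

sumℤ-++ : (ys zs : List ℤ) → sumℤ (ys ++ zs) ≡ sumℤ ys +ᶻ sumℤ zs
sumℤ-++ [] zs = sym (ℤ.+-identityˡ _)
sumℤ-++ (y ∷ ys) zs = trans (cong (y +ᶻ_) (sumℤ-++ ys zs)) (sym (ℤ.+-assoc y _ _))

sumℤ-map-when : {X : Set} (P? : Dec P) (F : X → ℤ) (xs : List X) →
  sumℤ (List.map (when P? ∘ F) xs) ≡ when P? (sumℤ (List.map F xs))
sumℤ-map-when P? F [] = sym (when-0 P?)
sumℤ-map-when P? F (x ∷ xs) =
  trans (cong (when P? (F x) +ᶻ_) (sumℤ-map-when P? F xs)) (when-+ P? (F x) _)

sumℤ-map-- : {X : Set} (F G : X → ℤ) (xs : List X) →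
  sumℤ (List.map (λ x → F x -ᶻ G x) xs) ≡ sumℤ (List.map F xs) -ᶻ sumℤ (List.map G xs)
sumℤ-map-- F G [] = refl
sumℤ-map-- F G (x ∷ xs) =
  trans (cong ((F x -ᶻ G x) +ᶻ_) (sumℤ-map-- F G xs)) (regroup (F x) (G x) _ _)
  where
  regroup : ∀ a b c e → (a -ᶻ b) +ᶻ (c -ᶻ e) ≡ (a +ᶻ c) -ᶻ (b +ᶻ e)
  regroup = solve-∀

sumℤ-concatMap : {X Y : Set} (F : Y → ℤ) (G : X → List Y) (xs : List X) →
  sumℤ (List.map F (List.concatMap G xs)) ≡ sumℤ (List.map (λ x → sumℤ (List.map F (G x))) xs)
sumℤ-concatMap F G [] = refl
sumℤ-concatMap F G (x ∷ xs) = begin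
  sumℤ (List.map F (G x ++ List.concatMap G xs))
    ≡⟨ cong sumℤ (List.map-++ F (G x) _) ⟩
  sumℤ (List.map F (G x) ++ List.map F (List.concatMap G xs))
    ≡⟨ sumℤ-++ (List.map F (G x)) _ ⟩
  sumℤ (List.map F (G x)) +ᶻ sumℤ (List.map F (List.concatMap G xs))
    ≡⟨ cong (sumℤ (List.map F (G x)) +ᶻ_) (sumℤ-concatMap F G xs) ⟩
  sumℤ (List.map (λ x → sumℤ (List.map F (G x))) (x ∷ xs)) ∎
  where open ≡-Reasoning

sumUpTo : ℕ → (ℕ → ℤ) → ℤ
sumUpTo n F = sumℤ (applyUpTo F n)

sumUpTo-cong : ∀ n {F G : ℕ → ℤ} → (∀ i → F i ≡ G i) → sumUpTo n F ≡ sumUpTo n G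
sumUpTo-cong zero F≗G = refl
sumUpTo-cong (suc n) F≗G = cong₂ _+ᶻ_ (F≗G 0) (sumUpTo-cong n (F≗G ∘ suc))

sumUpTo-zero : ∀ n → sumUpTo n (λ _ → + 0) ≡ + 0
sumUpTo-zero zero = refl
sumUpTo-zero (suc n) = trans (ℤ.+-identityˡ _) (sumUpTo-zero n)

sumUpTo-when : (P? : Dec P) (n : ℕ) (F : ℕ → ℤ) → sumUpTo n (when P? ∘ F) ≡ when P? (sumUpTo n F)
sumUpTo-when P? zero F = sym (when-0 P?)
sumUpTo-when P? (suc n) F =
  trans (cong (when P? (F 0) +ᶻ_) (sumUpTo-when P? n (F ∘ suc))) (when-+ P? (F 0) _)

sumUpTo-delta : ∀ n a (H : ℕ → ℤ) → sumUpTo n (λ i → when (a ≟ i) (H i)) ≡ when (a ℕ.<? n) (H a)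
sumUpTo-delta zero a H = refl
sumUpTo-delta (suc n) zero H = begin
  H 0 +ᶻ sumUpTo n (λ i → when (0 ≟ suc i) (H (suc i)))
    ≡⟨ cong (H 0 +ᶻ_) (trans (sumUpTo-cong n (λ i → when-no (0 ≟ suc i) {H (suc i)} λ ())) (sumUpTo-zero n)) ⟩
  H 0 +ᶻ + 0
    ≡⟨ ℤ.+-identityʳ (H 0) ⟩
  H 0 ∎
  where open ≡-Reasoning
sumUpTo-delta (suc n) (suc a) H = begin
  + 0 +ᶻ sumUpTo n (λ i → when (suc a ≟ suc i) (H (suc i)))
    ≡⟨ ℤ.+-identityˡ _ ⟩
  sumUpTo n (λ i → when (suc a ≟ suc i) (H (suc i)))
    ≡⟨ sumUpTo-cong n (λ i → when-⇔ (suc a ≟ suc i) (a ≟ i) (mk⇔ ℕ.suc-injective (cong suc))) ⟩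
  sumUpTo n (λ i → when (a ≟ i) (H (suc i)))
    ≡⟨ sumUpTo-delta n a (H ∘ suc) ⟩
  when (a ℕ.<? n) (H (suc a))
    ≡⟨ when-⇔ (a ℕ.<? n) (suc a ℕ.<? suc n) (mk⇔ s≤s ℕ.s≤s⁻¹) ⟩
  when (suc a ℕ.<? suc n) (H (suc a)) ∎
  where open ≡-Reasoning

sumUpTo-delta-last : ∀ x (H : ℕ → ℤ) → sumUpTo (suc x) (λ i → when (0 ≟ x ∸ i) (H i)) ≡ H x
sumUpTo-delta-last zero H = ℤ.+-identityʳ (H 0)
sumUpTo-delta-last (suc x) H =
  trans (ℤ.+-identityˡ _) (sumUpTo-delta-last x (H ∘ suc))

sumUpTo-peel-guarded : ∀ x a (K : ℕ → ℤ) →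
  when (a ≤? suc x) (K 0) +ᶻ when (a ≤? x) (sumUpTo (suc (x ∸ a)) (K ∘ suc))
    ≡ when (a ≤? suc x) (sumUpTo (suc (suc x ∸ a)) K)
sumUpTo-peel-guarded x a K with ℕ.<-cmp a (suc x)
... | tri< a<1+x _ _ = begin
  when (a ≤? suc x) (K 0) +ᶻ when (a ≤? x) (sumUpTo (suc (x ∸ a)) (K ∘ suc))
    ≡⟨ cong₂ _+ᶻ_ (when-yes (a ≤? suc x) a≤1+x) (when-yes (a ≤? x) a≤x) ⟩
  sumUpTo (suc (suc (x ∸ a))) K
    ≡⟨ cong (λ t → sumUpTo (suc t) K) (ℕ.+-∸-assoc 1 a≤x) ⟨
  sumUpTo (suc (suc x ∸ a)) K
    ≡⟨ when-yes (a ≤? suc x) a≤1+x ⟨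
  when (a ≤? suc x) (sumUpTo (suc (suc x ∸ a)) K) ∎
  where
  open ≡-Reasoning
  a≤x = ℕ.s≤s⁻¹ a<1+x
  a≤1+x = ℕ.<⇒≤ a<1+x
... | tri≈ _ refl _ = begin
  when (suc x ≤? suc x) (K 0) +ᶻ when (suc x ≤? x) (sumUpTo (suc (x ∸ suc x)) (K ∘ suc))
    ≡⟨ cong₂ _+ᶻ_ (when-yes (suc x ≤? suc x) ℕ.≤-refl) (when-no (suc x ≤? x) (ℕ.<-irrefl refl)) ⟩
  sumUpTo 1 K
    ≡⟨ cong (λ t → sumUpTo (suc t) K) (ℕ.n∸n≡0 x) ⟨
  sumUpTo (suc (x ∸ x)) K
    ≡⟨ when-yes (suc x ≤? suc x) ℕ.≤-refl ⟨
  when (suc x ≤? suc x) (sumUpTo (suc (x ∸ x)) K) ∎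
  where open ≡-Reasoning
... | tri> _ _ 1+x<a =
  trans (cong₂ _+ᶻ_ (when-no (a ≤? suc x) a≰1+x) (when-no (a ≤? x) (a≰1+x ∘ ℕ.m≤n⇒m≤1+n)))
        (sym (when-no (a ≤? suc x) a≰1+x))
  where
  a≰1+x = ℕ.<⇒≱ 1+x<a

sumUpTo-guard-∸ : ∀ x a (K : ℕ → ℤ) →
  sumUpTo (suc x) (λ i → when (a ≤? x ∸ i) (K i)) ≡ when (a ≤? x) (sumUpTo (suc (x ∸ a)) K)
sumUpTo-guard-∸ zero zero K = refl
sumUpTo-guard-∸ zero (suc a) K = refl
sumUpTo-guard-∸ (suc x) a K =
  trans (cong (when (a ≤? suc x) (K 0) +ᶻ_) (sumUpTo-guard-∸ x a (K ∘ suc))) (sumUpTo-peel-guarded x a K)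

-- Coordinates are read as 0 beyond the length of the vector.
at : ∀ {n} → Vec ℕ n → ℕ → ℕ
at [] _ = 0
at (x ∷ xs) zero = x
at (x ∷ xs) (suc j) = at xs j

at-zipWith : ∀ {n} (f : ℕ → ℕ → ℕ) → f 0 0 ≡ 0 → (u v : Vec ℕ n) →
  ∀ j → at (Vec.zipWith f u v) j ≡ f (at u j) (at v j)
at-zipWith f f00 [] [] j = sym f00
at-zipWith f f00 (x ∷ u) (y ∷ v) zero = refl
at-zipWith f f00 (x ∷ u) (y ∷ v) (suc j) = at-zipWith f f00 u v j

_+ᵛ_ : Exp d → Exp d → Exp d
_+ᵛ_ = Vec.zipWith _+_

0ᵛ : Exp d
0ᵛ = replicate _ 0

at-+ᵛ : (u v : Exp d) → ∀ j → at (u +ᵛ v) j ≡ at u j + at v j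
at-+ᵛ = at-zipWith _+_ refl

at-∸ᵛ : (u v : Exp d) → ∀ j → at (u ∸ᵛ v) j ≡ at u j ∸ at v j
at-∸ᵛ = at-zipWith _∸_ refl

at-replicate : ∀ n x j → j < n → at (replicate n x) j ≡ x
at-replicate (suc n) x zero _ = refl
at-replicate (suc n) x (suc j) j<n = at-replicate n x j (ℕ.s≤s⁻¹ j<n)

at-0ᵛ : ∀ n j → at (replicate n 0) j ≡ 0
at-0ᵛ zero j = refl
at-0ᵛ (suc n) zero = refl
at-0ᵛ (suc n) (suc j) = at-0ᵛ n j

at-≥ : ∀ {n} (v : Vec ℕ n) j → n ≤ j → at v j ≡ 0
at-≥ [] j _ = refl
at-≥ (x ∷ v) (suc j) n≤j = at-≥ v j (ℕ.s≤s⁻¹ n≤j)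

_≤ᵛ_ : Exp d → Exp d → Set
_≤ᵛ_ = Pointwise _≤_

_≤ᵛ?_ : (u v : Exp d) → Dec (u ≤ᵛ v)
_≤ᵛ?_ = Pointwise.decidable _≤?_

≤ᵛ⇒at≤ : {u v : Exp d} → u ≤ᵛ v → ∀ j → at u j ≤ at v j
≤ᵛ⇒at≤ [] j = z≤n
≤ᵛ⇒at≤ (x≤y ∷ _) zero = x≤y
≤ᵛ⇒at≤ (_ ∷ u≤v) (suc j) = ≤ᵛ⇒at≤ u≤v j

at≤⇒≤ᵛ : (u v : Exp d) → (∀ j → at u j ≤ at v j) → u ≤ᵛ v
at≤⇒≤ᵛ [] [] _ = []
at≤⇒≤ᵛ (x ∷ u) (y ∷ v) u≤v = u≤v 0 ∷ at≤⇒≤ᵛ u v (u≤v ∘ suc)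

0ᵛ-≤ᵛ : (e : Exp d) → 0ᵛ ≤ᵛ e
0ᵛ-≤ᵛ [] = []
0ᵛ-≤ᵛ (x ∷ e) = z≤n ∷ 0ᵛ-≤ᵛ e

∸ᵛ-0ᵛ : (e : Exp d) → e ∸ᵛ 0ᵛ ≡ e
∸ᵛ-0ᵛ [] = refl
∸ᵛ-0ᵛ (x ∷ e) = cong (x ∷_) (∸ᵛ-0ᵛ e)

+ᵛ-comm : (u v : Exp d) → u +ᵛ v ≡ v +ᵛ u
+ᵛ-comm [] [] = refl
+ᵛ-comm (x ∷ u) (y ∷ v) = cong₂ _∷_ (ℕ.+-comm x y) (+ᵛ-comm u v)

+ᵛ-left-comm : (u v w : Exp d) → u +ᵛ (v +ᵛ w) ≡ v +ᵛ (u +ᵛ w)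
+ᵛ-left-comm [] [] [] = refl
+ᵛ-left-comm (x ∷ u) (y ∷ v) (z ∷ w) = cong₂ _∷_ (x∙yz≈y∙xz x y z) (+ᵛ-left-comm u v w)

∸ᵛ-+ᵛ-assoc : (k m c : Exp d) → (k ∸ᵛ m) ∸ᵛ c ≡ k ∸ᵛ (m +ᵛ c)
∸ᵛ-+ᵛ-assoc [] [] [] = refl
∸ᵛ-+ᵛ-assoc (x ∷ k) (y ∷ m) (z ∷ c) = cong₂ _∷_ (ℕ.∸-+-assoc x y z) (∸ᵛ-+ᵛ-assoc k m c)

+ᵛ-≤ᵛ⇔ : (m c k : Exp d) → (m +ᵛ c) ≤ᵛ k ⇔ (m ≤ᵛ k × c ≤ᵛ (k ∸ᵛ m))
+ᵛ-≤ᵛ⇔ m c k = mk⇔ (to m c k) (λ (m≤k , c≤k∸m) → from m≤k c≤k∸m)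
  where
  to : (m c k : Exp d) → (m +ᵛ c) ≤ᵛ k → m ≤ᵛ k × c ≤ᵛ (k ∸ᵛ m)
  to [] [] [] [] = [] , []
  to (x ∷ m) (z ∷ c) (y ∷ k) (x+z≤y ∷ m+c≤k) =
    (ℕ.m+n≤o⇒m≤o x x+z≤y ∷ proj₁ (to m c k m+c≤k)) ,
    (ℕ.m+n≤o⇒m≤o∸n z (ℕ.≤-trans (ℕ.≤-reflexive (ℕ.+-comm z x)) x+z≤y) ∷ proj₂ (to m c k m+c≤k))
  from : {m c k : Exp d} → m ≤ᵛ k → c ≤ᵛ (k ∸ᵛ m) → (m +ᵛ c) ≤ᵛ k
  from [] [] = []
  from (x≤y ∷ m≤k) (z≤y∸x ∷ c≤k∸m) =
    ℕ.≤-trans (ℕ.+-monoʳ-≤ _ z≤y∸x) (ℕ.≤-reflexive (ℕ.m+[n∸m]≡n x≤y)) ∷ from m≤k c≤k∸m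

-- Products with monomials

slice : FPS (suc d) → ℕ → FPS d
slice f i v = f (i ∷ v)

shift : Exp d → FPS d → FPS d
shift m g w = when (m ≤ᵛ? w) (g (w ∸ᵛ m))

shift-0ᵛ : (g : FPS d) → shift 0ᵛ g ≐ g
shift-0ᵛ g e = trans (when-yes (0ᵛ ≤ᵛ? e) (0ᵛ-≤ᵛ e)) (cong g (∸ᵛ-0ᵛ e))

-- Pointwise.decidable decides a cons with _×-dec_, so this is when-× read backwards.
shift-∷ : ∀ a (m : Exp d) (g : FPS (suc d)) y w →
  shift (a ∷ m) g (y ∷ w) ≡ when (a ≤? y) (shift m (slice g (y ∸ a)) w)
shift-∷ a m g y w = sym (when-× (a ≤? y) (m ≤ᵛ? w))

shift-+ᵛ : (m c : Exp d) (f : FPS d) (k : Exp d) → shift (m +ᵛ c) f k ≡ when (m ≤ᵛ? k) (shift c f (k ∸ᵛ m))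
shift-+ᵛ m c f k = begin
  when ((m +ᵛ c) ≤ᵛ? k) (f (k ∸ᵛ (m +ᵛ c)))
    ≡⟨ cong (when ((m +ᵛ c) ≤ᵛ? k) ∘ f) (sym (∸ᵛ-+ᵛ-assoc k m c)) ⟩
  when ((m +ᵛ c) ≤ᵛ? k) (f ((k ∸ᵛ m) ∸ᵛ c))
    ≡⟨ when-⇔ ((m +ᵛ c) ≤ᵛ? k) ((m ≤ᵛ? k) ×-dec (c ≤ᵛ? (k ∸ᵛ m))) (+ᵛ-≤ᵛ⇔ m c k) ⟩
  when ((m ≤ᵛ? k) ×-dec (c ≤ᵛ? (k ∸ᵛ m))) (f ((k ∸ᵛ m) ∸ᵛ c))
    ≡⟨ sym (when-× (m ≤ᵛ? k) (c ≤ᵛ? (k ∸ᵛ m))) ⟩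
  when (m ≤ᵛ? k) (shift c f (k ∸ᵛ m)) ∎
  where open ≡-Reasoning

mono-∷ : ∀ a (m : Exp d) i → slice (mono (a ∷ m)) i ≐ (when (a ≟ i) ∘ mono m)
mono-∷ a m i v = guard-∧ (a ℕ.≡ᵇ i)
  where
  guard-∧ : ∀ b → (if b ∧ (m ==ᵛ v) then + 1 else + 0) ≡ (if b then mono m v else + 0)
  guard-∧ true = refl
  guard-∧ false = refl

⋆-congˡ : {f f′ : FPS d} (g : FPS d) → f ≐ f′ → (f ⋆ g) ≐ (f′ ⋆ g)
⋆-congˡ g f≐f′ e = cong sumℤ (List.map-cong (λ e′ → cong (_*ᶻ g (e ∸ᵛ e′)) (f≐f′ e′)) (box e))

⋆-congʳ : (f : FPS d) {g g′ : FPS d} → g ≐ g′ → (f ⋆ g) ≐ (f ⋆ g′)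
⋆-congʳ f g≐g′ e = cong sumℤ (List.map-cong (λ e′ → cong (f e′ *ᶻ_) (g≐g′ (e ∸ᵛ e′))) (box e))

⋆-∷ : (f g : FPS (suc d)) (x : ℕ) (xs : Exp d) →
  (f ⋆ g) (x ∷ xs) ≡ sumUpTo (suc x) (λ i → (slice f i ⋆ slice g (x ∸ i)) xs)
⋆-∷ f g x xs = begin
  (f ⋆ g) (x ∷ xs)
    ≡⟨ sumℤ-concatMap term (λ i → List.map (i ∷_) (box xs)) (upTo (suc x)) ⟩
  sumℤ (List.map (λ i → sumℤ (List.map term (List.map (i ∷_) (box xs)))) (upTo (suc x)))
    ≡⟨ cong sumℤ (List.map-cong (λ i → cong sumℤ (sym (List.map-∘ (box xs)))) (upTo (suc x))) ⟩
  sumℤ (List.map (λ i → (slice f i ⋆ slice g (x ∸ i)) xs) (upTo (suc x)))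
    ≡⟨ cong sumℤ (List.map-upTo (λ i → (slice f i ⋆ slice g (x ∸ i)) xs) (suc x)) ⟩
  sumUpTo (suc x) (λ i → (slice f i ⋆ slice g (x ∸ i)) xs) ∎
  where
  open ≡-Reasoning
  term : Exp (suc _) → ℤ
  term e′ = f e′ *ᶻ g ((x ∷ xs) ∸ᵛ e′)

⋆-whenˡ : (P? : Dec P) (f g : FPS d) → ((when P? ∘ f) ⋆ g) ≐ (when P? ∘ (f ⋆ g))
⋆-whenˡ P? f g e =
  trans (cong sumℤ (List.map-cong (λ e′ → when-*ˡ P? (f e′) (g (e ∸ᵛ e′))) (box e)))
        (sumℤ-map-when P? (λ e′ → f e′ *ᶻ g (e ∸ᵛ e′)) (box e))

⋆-whenʳ : (P? : Dec P) (f g : FPS d) → (f ⋆ (when P? ∘ g)) ≐ (when P? ∘ (f ⋆ g))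
⋆-whenʳ P? f g e =
  trans (cong sumℤ (List.map-cong (λ e′ → when-*ʳ P? (f e′) (g (e ∸ᵛ e′))) (box e)))
        (sumℤ-map-when P? (λ e′ → f e′ *ᶻ g (e ∸ᵛ e′)) (box e))

⋆-⊝-distribˡ : (f g h : FPS d) → ((g ⊝ h) ⋆ f) ≐ ((g ⋆ f) ⊝ (h ⋆ f))
⋆-⊝-distribˡ f g h e =
  trans (cong sumℤ (List.map-cong (λ e′ → distrib (f (e ∸ᵛ e′)) (g e′) (h e′)) (box e)))
        (sumℤ-map-- (λ e′ → g e′ *ᶻ f (e ∸ᵛ e′)) (λ e′ → h e′ *ᶻ f (e ∸ᵛ e′)) (box e))
  where
  distrib : ∀ a b c → (b -ᶻ c) *ᶻ a ≡ b *ᶻ a -ᶻ c *ᶻ a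
  distrib = solve-∀

⋆-⊝-distribʳ : (f g h : FPS d) → (f ⋆ (g ⊝ h)) ≐ ((f ⋆ g) ⊝ (f ⋆ h))
⋆-⊝-distribʳ f g h e =
  trans (cong sumℤ (List.map-cong (λ e′ → distrib (f e′) (g (e ∸ᵛ e′)) (h (e ∸ᵛ e′))) (box e)))
        (sumℤ-map-- (λ e′ → f e′ *ᶻ g (e ∸ᵛ e′)) (λ e′ → f e′ *ᶻ h (e ∸ᵛ e′)) (box e))
  where
  distrib : ∀ a b c → a *ᶻ (b -ᶻ c) ≡ a *ᶻ b -ᶻ a *ᶻ c
  distrib = solve-∀

⋆-identityʳ : (f : FPS d) → (f ⋆ oneS) ≐ f
⋆-identityʳ f [] = trans (ℤ.+-identityʳ _) (ℤ.*-identityʳ (f []))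
⋆-identityʳ f (x ∷ xs) = begin
  (f ⋆ oneS) (x ∷ xs)
    ≡⟨ ⋆-∷ f oneS x xs ⟩
  sumUpTo (suc x) (λ i → (slice f i ⋆ slice oneS (x ∸ i)) xs)
    ≡⟨ sumUpTo-cong (suc x) (λ i →
         trans (⋆-congʳ (slice f i) {slice oneS (x ∸ i)} (mono-∷ 0 0ᵛ (x ∸ i)) xs)
               (⋆-whenʳ (0 ≟ x ∸ i) (slice f i) oneS xs)) ⟩
  sumUpTo (suc x) (λ i → when (0 ≟ x ∸ i) ((slice f i ⋆ oneS) xs))
    ≡⟨ sumUpTo-cong (suc x) (λ i → cong (when (0 ≟ x ∸ i)) (⋆-identityʳ (slice f i) xs)) ⟩
  sumUpTo (suc x) (λ i → when (0 ≟ x ∸ i) (f (i ∷ xs)))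
    ≡⟨ sumUpTo-delta-last x (λ i → f (i ∷ xs)) ⟩
  f (x ∷ xs) ∎
  where open ≡-Reasoning

⋆-monoˡ : (m : Exp d) (g : FPS d) → (mono m ⋆ g) ≐ shift m g
⋆-monoˡ [] g [] = trans (ℤ.+-identityʳ _) (ℤ.*-identityˡ (g []))
⋆-monoˡ (a ∷ m) g (x ∷ xs) = begin
  (mono (a ∷ m) ⋆ g) (x ∷ xs)
    ≡⟨ ⋆-∷ (mono (a ∷ m)) g x xs ⟩
  sumUpTo (suc x) (λ i → (slice (mono (a ∷ m)) i ⋆ slice g (x ∸ i)) xs)
    ≡⟨ sumUpTo-cong (suc x) (λ i →
         trans (⋆-congˡ {f = slice (mono (a ∷ m)) i} (slice g (x ∸ i)) (mono-∷ a m i) xs)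
               (⋆-whenˡ (a ≟ i) (mono m) (slice g (x ∸ i)) xs)) ⟩
  sumUpTo (suc x) (λ i → when (a ≟ i) ((mono m ⋆ slice g (x ∸ i)) xs))
    ≡⟨ sumUpTo-cong (suc x) (λ i → cong (when (a ≟ i)) (⋆-monoˡ m (slice g (x ∸ i)) xs)) ⟩
  sumUpTo (suc x) (λ i → when (a ≟ i) (shift m (slice g (x ∸ i)) xs))
    ≡⟨ sumUpTo-delta (suc x) a (λ i → shift m (slice g (x ∸ i)) xs) ⟩
  when (a ℕ.<? suc x) (shift m (slice g (x ∸ a)) xs)
    ≡⟨ when-⇔ (a ℕ.<? suc x) (a ≤? x) (mk⇔ ℕ.s≤s⁻¹ s≤s) ⟩
  when (a ≤? x) (shift m (slice g (x ∸ a)) xs)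
    ≡⟨ sym (shift-∷ a m g x xs) ⟩
  shift (a ∷ m) g (x ∷ xs) ∎
  where open ≡-Reasoning

⋆-shiftʳ : (m : Exp d) (f g : FPS d) → (f ⋆ shift m g) ≐ shift m (f ⋆ g)
⋆-shiftʳ [] f g [] = refl
⋆-shiftʳ (a ∷ m) f g (x ∷ xs) = begin
  (f ⋆ shift (a ∷ m) g) (x ∷ xs)
    ≡⟨ ⋆-∷ f (shift (a ∷ m) g) x xs ⟩
  sumUpTo (suc x) (λ i → (slice f i ⋆ slice (shift (a ∷ m) g) (x ∸ i)) xs)
    ≡⟨ sumUpTo-cong (suc x) (λ i →
         trans (⋆-congʳ (slice f i) {slice (shift (a ∷ m) g) (x ∸ i)} (shift-∷ a m g (x ∸ i)) xs)
               (⋆-whenʳ (a ≤? x ∸ i) (slice f i) (shift m (slice g (x ∸ i ∸ a))) xs)) ⟩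
  sumUpTo (suc x) (λ i → when (a ≤? x ∸ i) ((slice f i ⋆ shift m (slice g (x ∸ i ∸ a))) xs))
    ≡⟨ sumUpTo-cong (suc x) (λ i → cong (when (a ≤? x ∸ i)) (trans
         (⋆-shiftʳ m (slice f i) (slice g (x ∸ i ∸ a)) xs)
         (cong (λ t → shift m (slice f i ⋆ slice g t) xs) (∸-comm x i a)))) ⟩
  sumUpTo (suc x) (λ i → when (a ≤? x ∸ i) (shift m (slice f i ⋆ slice g (x ∸ a ∸ i)) xs))
    ≡⟨ sumUpTo-guard-∸ x a (λ i → shift m (slice f i ⋆ slice g (x ∸ a ∸ i)) xs) ⟩
  when (a ≤? x) (sumUpTo (suc (x ∸ a)) (λ i → shift m (slice f i ⋆ slice g (x ∸ a ∸ i)) xs))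
    ≡⟨ cong (when (a ≤? x)) (sumUpTo-when (m ≤ᵛ? xs) (suc (x ∸ a)) (λ i → (slice f i ⋆ slice g (x ∸ a ∸ i)) (xs ∸ᵛ m))) ⟩
  when (a ≤? x) (shift m (λ w → sumUpTo (suc (x ∸ a)) (λ i → (slice f i ⋆ slice g (x ∸ a ∸ i)) w)) xs)
    ≡⟨ cong (when (a ≤? x) ∘ when (m ≤ᵛ? xs)) (sym (⋆-∷ f g (x ∸ a) (xs ∸ᵛ m))) ⟩
  when (a ≤? x) (shift m (slice (f ⋆ g) (x ∸ a)) xs)
    ≡⟨ sym (shift-∷ a m (f ⋆ g) x xs) ⟩
  shift (a ∷ m) (f ⋆ g) (x ∷ xs) ∎
  where
  open ≡-Reasoning
  ∸-comm : ∀ x i a → x ∸ i ∸ a ≡ x ∸ a ∸ i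
  ∸-comm x i a = trans (ℕ.∸-+-assoc x i a) (trans (cong (x ∸_) (ℕ.+-comm i a)) (sym (ℕ.∸-+-assoc x a i)))

-- Inclusion–exclusion

-- signedSubsetSum L F = Σ_{S ⊆ L} (-1)^{|S|} F (Σ S); the sums Σ S are the c with SubsetSum L c.
signedSubsetSum : List (Exp d) → (Exp d → ℤ) → ℤ
signedSubsetSum [] F = F 0ᵛ
signedSubsetSum (m ∷ L) F = signedSubsetSum L F -ᶻ signedSubsetSum L (F ∘ (m +ᵛ_))

data SubsetSum {d} : List (Exp d) → Exp d → Set where
  []   : SubsetSum [] 0ᵛ
  skip : ∀ {m L c} → SubsetSum L c → SubsetSum (m ∷ L) c
  take : ∀ {m L c} → SubsetSum L c → SubsetSum (m ∷ L) (m +ᵛ c)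

SubsetSum-insert : (pre post : List (Exp d)) (m : Exp d) {c : Exp d} →
  SubsetSum (pre ++ post) c → SubsetSum (pre ++ m ∷ post) c
SubsetSum-insert [] post m s = skip s
SubsetSum-insert (x ∷ pre) post m (skip s) = skip (SubsetSum-insert pre post m s)
SubsetSum-insert (x ∷ pre) post m (take s) = take (SubsetSum-insert pre post m s)

signedSubsetSum-cong : (L : List (Exp d)) {F G : Exp d → ℤ} →
  (∀ c → SubsetSum L c → F c ≡ G c) → signedSubsetSum L F ≡ signedSubsetSum L G
signedSubsetSum-cong [] F≗G = F≗G 0ᵛ []
signedSubsetSum-cong (m ∷ L) F≗G =
  cong₂ _-ᶻ_ (signedSubsetSum-cong L (λ c → F≗G c ∘ skip))
             (signedSubsetSum-cong L (λ c → F≗G (m +ᵛ c) ∘ take))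

signedSubsetSum-when : (P? : Dec P) (L : List (Exp d)) (F : Exp d → ℤ) →
  signedSubsetSum L (when P? ∘ F) ≡ when P? (signedSubsetSum L F)
signedSubsetSum-when P? [] F = refl
signedSubsetSum-when P? (m ∷ L) F =
  trans (cong₂ _-ᶻ_ (signedSubsetSum-when P? L F) (signedSubsetSum-when P? L (F ∘ (m +ᵛ_))))
        (when-- P? _ _)

signedSubsetSum-- : (L : List (Exp d)) (F G : Exp d → ℤ) →
  signedSubsetSum L (λ c → F c -ᶻ G c) ≡ signedSubsetSum L F -ᶻ signedSubsetSum L G
signedSubsetSum-- [] F G = refl
signedSubsetSum-- (m ∷ L) F G =
  trans (cong₂ _-ᶻ_ (signedSubsetSum-- L F G) (signedSubsetSum-- L (F ∘ (m +ᵛ_)) (G ∘ (m +ᵛ_))))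
        (regroup (signedSubsetSum L F) (signedSubsetSum L G) _ _)
  where
  regroup : ∀ a b c e → (a -ᶻ b) -ᶻ (c -ᶻ e) ≡ (a -ᶻ c) -ᶻ (b -ᶻ e)
  regroup = solve-∀

signedSubsetSum-const : (m : Exp d) (L : List (Exp d)) (z : ℤ) → signedSubsetSum (m ∷ L) (λ _ → z) ≡ + 0
signedSubsetSum-const m L z = ℤ.+-inverseʳ (signedSubsetSum L (λ _ → z))

signedSubsetSum-zero : (L : List (Exp d)) → signedSubsetSum L (λ _ → + 0) ≡ + 0
signedSubsetSum-zero [] = refl
signedSubsetSum-zero (m ∷ L) = signedSubsetSum-const m L (+ 0)

signedSubsetSum-origin : (L : List (Exp d)) (F : Exp d → ℤ) →
  ListAll.All (λ m → ∀ c → F (m +ᵛ c) ≡ + 0) L → signedSubsetSum L F ≡ F 0ᵛ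
signedSubsetSum-origin [] F [] = refl
signedSubsetSum-origin (m ∷ L) F (F[m+]≡0 ∷ rest) = begin
  signedSubsetSum L F -ᶻ signedSubsetSum L (F ∘ (m +ᵛ_))
    ≡⟨ cong₂ _-ᶻ_ (signedSubsetSum-origin L F rest) (signedSubsetSum-cong L (λ c _ → F[m+]≡0 c)) ⟩
  F 0ᵛ -ᶻ signedSubsetSum L (λ _ → + 0)
    ≡⟨ cong (F 0ᵛ -ᶻ_) (signedSubsetSum-zero L) ⟩
  F 0ᵛ +ᶻ + 0
    ≡⟨ ℤ.+-identityʳ (F 0ᵛ) ⟩
  F 0ᵛ ∎
  where open ≡-Reasoning

signedSubsetSum-cancel : (pre post : List (Exp d)) (m : Exp d) (F : Exp d → ℤ) →
  (∀ c → SubsetSum (pre ++ post) c → F c ≡ F (m +ᵛ c)) → signedSubsetSum (pre ++ m ∷ post) F ≡ + 0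
signedSubsetSum-cancel [] post m F F≗F[m+] =
  trans (cong (signedSubsetSum post F -ᶻ_) (sym (signedSubsetSum-cong post F≗F[m+])))
        (ℤ.+-inverseʳ (signedSubsetSum post F))
signedSubsetSum-cancel (x ∷ pre) post m F F≗F[m+] =
  cong₂ _-ᶻ_ (signedSubsetSum-cancel pre post m F (λ c → F≗F[m+] c ∘ skip))
             (signedSubsetSum-cancel pre post m (F ∘ (x +ᵛ_))
               (λ c s → trans (F≗F[m+] (x +ᵛ c) (take s)) (cong F (+ᵛ-left-comm m x c))))

∏[1-xᵐ] : List (Exp d) → FPS d
∏[1-xᵐ] L = List.foldr _⋆_ oneS (List.map (λ m → oneS ⊝ mono m) L)

⋆-∏[1-xᵐ] : (f : FPS d) (L : List (Exp d)) → (f ⋆ ∏[1-xᵐ] L) ≐ (λ k → signedSubsetSum L (λ c → shift c f k))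
⋆-∏[1-xᵐ] f [] k = trans (⋆-identityʳ f k) (sym (shift-0ᵛ f k))
⋆-∏[1-xᵐ] f (m ∷ L) k = begin
  (f ⋆ ((oneS ⊝ mono m) ⋆ R)) k
    ≡⟨ ⋆-congʳ f {(oneS ⊝ mono m) ⋆ R} one-minus-x^m k ⟩
  (f ⋆ (R ⊝ shift m R)) k
    ≡⟨ ⋆-⊝-distribʳ f R (shift m R) k ⟩
  (f ⋆ R) k -ᶻ (f ⋆ shift m R) k
    ≡⟨ cong ((f ⋆ R) k -ᶻ_) (⋆-shiftʳ m f R k) ⟩
  (f ⋆ R) k -ᶻ shift m (f ⋆ R) k
    ≡⟨ cong₂ _-ᶻ_ (⋆-∏[1-xᵐ] f L k) (cong (when (m ≤ᵛ? k)) (⋆-∏[1-xᵐ] f L (k ∸ᵛ m))) ⟩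
  S k -ᶻ when (m ≤ᵛ? k) (S (k ∸ᵛ m))
    ≡⟨ cong (S k -ᶻ_) (sym (signedSubsetSum-when (m ≤ᵛ? k) L (λ c → shift c f (k ∸ᵛ m)))) ⟩
  S k -ᶻ signedSubsetSum L (λ c → when (m ≤ᵛ? k) (shift c f (k ∸ᵛ m)))
    ≡⟨ cong (S k -ᶻ_) (signedSubsetSum-cong L (λ c _ → sym (shift-+ᵛ m c f k))) ⟩
  S k -ᶻ signedSubsetSum L (λ c → shift (m +ᵛ c) f k) ∎
  where
  open ≡-Reasoning
  R = ∏[1-xᵐ] L
  S : Exp _ → ℤ
  S k = signedSubsetSum L (λ c → shift c f k)
  one-minus-x^m : ((oneS ⊝ mono m) ⋆ R) ≐ (R ⊝ shift m R)
  one-minus-x^m e = trans (⋆-⊝-distribˡ R oneS (mono m) e)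
    (cong₂ _-ᶻ_ (trans (⋆-monoˡ 0ᵛ R e) (shift-0ᵛ R e)) (⋆-monoˡ m R e))

columnSum : List (Exp d) → ℕ → ℕ
columnSum L j = sum (List.map (λ m → at m j) L)

SubsetSum-at-≤ : {L : List (Exp d)} {c : Exp d} → SubsetSum L c → ∀ j → at c j ≤ columnSum L j
SubsetSum-at-≤ {d} [] j = ℕ.≤-reflexive (at-0ᵛ d j)
SubsetSum-at-≤ (skip {m} s) j = ℕ.≤-trans (SubsetSum-at-≤ s j) (ℕ.m≤n+m _ (at m j))
SubsetSum-at-≤ (take {m} {c = c} s) j =
  ℕ.≤-trans (ℕ.≤-reflexive (at-+ᵛ m c j)) (ℕ.+-monoʳ-≤ (at m j) (SubsetSum-at-≤ s j))

SubsetSum-at-≡ : {L : List (Exp d)} {c : Exp d} (a b : ℕ) →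
  ListAll.All (λ m → at m a ≡ at m b) L → SubsetSum L c → at c a ≡ at c b
SubsetSum-at-≡ {d} a b [] [] = trans (at-0ᵛ d a) (sym (at-0ᵛ d b))
SubsetSum-at-≡ a b (_ ∷ ms) (skip s) = SubsetSum-at-≡ a b ms s
SubsetSum-at-≡ a b (mₐ≡m_b ∷ ms) (take {m} {c = c} s) = begin
  at (m +ᵛ c) a   ≡⟨ at-+ᵛ m c a ⟩
  at m a + at c a ≡⟨ cong₂ _+_ mₐ≡m_b (SubsetSum-at-≡ a b ms s) ⟩
  at m b + at c b ≡⟨ at-+ᵛ m c b ⟨
  at (m +ᵛ c) b   ∎
  where open ≡-Reasoning

-- Equivalently, the complementary subset sum columnSum L ∸ c is antitone at j; stated without truncated subtraction.
SubsetSum-step : {L : List (Exp d)} {c : Exp d} (j : ℕ) →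
  ListAll.All (λ m → at m (suc j) ≤ at m j) L → SubsetSum L c →
  at c j + columnSum L (suc j) ≤ at c (suc j) + columnSum L j
SubsetSum-step {d} j [] [] =
  ℕ.≤-reflexive (cong (_+ 0) (trans (at-0ᵛ d j) (sym (at-0ᵛ d (suc j)))))
SubsetSum-step j (m′≤m ∷ ms) (skip {m} {L} {c} s) = begin
  at c j + (at m (suc j) + columnSum L (suc j))   ≡⟨ x∙yz≈y∙xz (at c j) (at m (suc j)) _ ⟩
  at m (suc j) + (at c j + columnSum L (suc j))   ≤⟨ ℕ.+-mono-≤ m′≤m (SubsetSum-step j ms s) ⟩
  at m j + (at c (suc j) + columnSum L j)         ≡⟨ x∙yz≈y∙xz (at m j) (at c (suc j)) _ ⟩
  at c (suc j) + (at m j + columnSum L j)         ∎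
  where open ℕ.≤-Reasoning
SubsetSum-step j (m′≤m ∷ ms) (take {m} {L} {c} s) = begin
  at (m +ᵛ c) j + (at m (suc j) + columnSum L (suc j))
    ≡⟨ cong (_+ (at m (suc j) + columnSum L (suc j))) (at-+ᵛ m c j) ⟩
  (at m j + at c j) + (at m (suc j) + columnSum L (suc j))
    ≡⟨ interchange (at m j) (at c j) (at m (suc j)) _ ⟩
  (at m j + at m (suc j)) + (at c j + columnSum L (suc j))
    ≤⟨ ℕ.+-monoʳ-≤ (at m j + at m (suc j)) (SubsetSum-step j ms s) ⟩
  (at m j + at m (suc j)) + (at c (suc j) + columnSum L j)
    ≡⟨ cong (_+ (at c (suc j) + columnSum L j)) (ℕ.+-comm (at m j) _) ⟩
  (at m (suc j) + at m j) + (at c (suc j) + columnSum L j)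
    ≡⟨ interchange (at m (suc j)) (at m j) (at c (suc j)) _ ⟩
  (at m (suc j) + at c (suc j)) + (at m j + columnSum L j)
    ≡⟨ cong (_+ (at m j + columnSum L j)) (at-+ᵛ m c (suc j)) ⟨
  at (m +ᵛ c) (suc j) + (at m j + columnSum L j) ∎
  where open ℕ.≤-Reasoning

at-prefixExp-< : ∀ d r j → j < d → j < r → at (prefixExp d r) j ≡ 1
at-prefixExp-< (suc d) (suc r) zero _ _ = refl
at-prefixExp-< (suc d) (suc r) (suc j) j<d j<r = at-prefixExp-< d r j (ℕ.s≤s⁻¹ j<d) (ℕ.s≤s⁻¹ j<r)

at-prefixExp-≥ : ∀ d r j → r ≤ j → at (prefixExp d r) j ≡ 0
at-prefixExp-≥ zero r j _ = refl
at-prefixExp-≥ (suc d) zero zero _ = refl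
at-prefixExp-≥ (suc d) zero (suc j) _ = at-prefixExp-≥ d zero j z≤n
at-prefixExp-≥ (suc d) (suc r) (suc j) r≤j = at-prefixExp-≥ d r j (ℕ.s≤s⁻¹ r≤j)

prefixExp-antitone : ∀ d r j → at (prefixExp d r) (suc j) ≤ at (prefixExp d r) j
prefixExp-antitone d r j with suc j ℕ.<? r | suc j ℕ.<? d
... | yes j+1<r | yes j+1<d = ℕ.≤-reflexive (trans (at-prefixExp-< d r (suc j) j+1<d j+1<r)
  (sym (at-prefixExp-< d r j (ℕ.<-trans (ℕ.n<1+n j) j+1<d) (ℕ.<-trans (ℕ.n<1+n j) j+1<r))))
... | no j+1≮r | _ = ℕ.≤-trans (ℕ.≤-reflexive (at-prefixExp-≥ d r (suc j) (ℕ.≮⇒≥ j+1≮r))) z≤n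
... | _ | no j+1≮d = ℕ.≤-trans (ℕ.≤-reflexive (at-≥ (prefixExp d r) (suc j) (ℕ.≮⇒≥ j+1≮d))) z≤n

-- prefix d r is the exponent of x₁⋯x_{r+1}, coordinates being numbered from 0.
prefix : (d r : ℕ) → Exp d
prefix d r = prefixExp d (suc r)

prefixes : (d : ℕ) → List (Exp d)
prefixes d = applyUpTo (prefix d) d

at-prefix-≤ : ∀ d r j → j ≤ r → r < d → at (prefix d r) j ≡ 1
at-prefix-≤ d r j j≤r r<d = at-prefixExp-< d (suc r) j (ℕ.≤-<-trans j≤r r<d) (s≤s j≤r)

at-prefix-> : ∀ d r j → r < j → at (prefix d r) j ≡ 0
at-prefix-> d r j = at-prefixExp-≥ d (suc r) j

denom-prefixes : ∀ d → denom d ≡ ∏[1-xᵐ] (prefixes d)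
denom-prefixes d = cong (List.foldr _⋆_ oneS)
  (trans (List.map-upTo _ d) (sym (List.map-applyUpTo (prefix d) (λ m → oneS ⊝ mono m) d)))

columnSum-applyUpTo : ∀ n t j (g : ℕ → Exp d) →
  (∀ r → r < t → at (g r) j ≡ 0) → (∀ r → t ≤ r → r < n → at (g r) j ≡ 1) →
  columnSum (applyUpTo g n) j ≡ n ∸ t
columnSum-applyUpTo zero t j g _ _ = sym (ℕ.0∸n≡0 t)
columnSum-applyUpTo (suc n) zero j g _ ones =
  cong₂ _+_ (ones 0 z≤n (s≤s z≤n))
    (columnSum-applyUpTo n zero j (g ∘ suc) (λ _ ()) (λ r _ r<n → ones (suc r) z≤n (s≤s r<n)))
columnSum-applyUpTo (suc n) (suc t) j g zeros ones =
  cong₂ _+_ (zeros 0 (s≤s z≤n))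
    (columnSum-applyUpTo n t j (g ∘ suc) (λ r r<t → zeros (suc r) (s≤s r<t))
      (λ r t≤r r<n → ones (suc r) (s≤s t≤r) (s≤s r<n)))

columnSum-prefixes : ∀ d j → columnSum (prefixes d) j ≡ d ∸ j
columnSum-prefixes d j = columnSum-applyUpTo d j j (prefix d)
  (λ r r<j → at-prefix-> d r j r<j) (λ r j≤r r<d → at-prefix-≤ d r j j≤r r<d)

applyUpTo-split : {X : Set} (f : ℕ → X) (i n : ℕ) →
  applyUpTo f (i + suc n) ≡ applyUpTo f i ++ f i ∷ applyUpTo (λ t → f (i + suc t)) n
applyUpTo-split f zero n = refl
applyUpTo-split f (suc i) n = cong (f 0 ∷_) (applyUpTo-split (f ∘ suc) i n)

-- Admissible exponents

Admissible : Exp d → Set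
Admissible v = ∀ j → at v (suc j) ≤ suc (at v j)

adm⇔Admissible : (v : Exp d) → T (adm v) ⇔ Admissible v
adm⇔Admissible v = mk⇔ (to v) (from v)
  where
  to : (v : Exp d) → T (adm v) → Admissible v
  to [] _ _ = z≤n
  to (k ∷ []) _ _ = z≤n
  to (k ∷ k′ ∷ ks) t zero = ℕ.≤ᵇ⇒≤ k′ (suc k) (proj₁ (Equivalence.to T-∧ t))
  to (k ∷ k′ ∷ ks) t (suc j) = to (k′ ∷ ks) (proj₂ (Equivalence.to T-∧ t)) j
  from : (v : Exp d) → Admissible v → T (adm v)
  from [] _ = _
  from (k ∷ []) _ = _
  from (k ∷ k′ ∷ ks) a = Equivalence.from T-∧ (ℕ.≤⇒≤ᵇ (a 0) , from (k′ ∷ ks) (a ∘ suc))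

admissible? : (v : Exp d) → Dec (Admissible v)
admissible? v = Dec.map (adm⇔Admissible v) (T? (adm v))

-- Holds by computation: Dec.map keeps the boolean adm v as the decision.
A-when : (v : Exp d) → A d v ≡ when (admissible? v) (+ 1)
A-when v = refl

Admissible-growth : (v : Exp d) → Admissible v → ∀ j t → at v (t + j) ≤ t + at v j
Admissible-growth v a j zero = ℕ.≤-refl
Admissible-growth v a j (suc t) = ℕ.≤-trans (a (t + j)) (s≤s (Admissible-growth v a j t))

Admissible-positive : (v : Exp d) → Admissible v → ∀ {i} → suc i ≤ at v i → ∀ {j} → j ≤ i → 1 ≤ at v j
Admissible-positive v a {i} i<vᵢ {j} j≤i = positive (at v j) i<[i∸j]+vⱼ
  where
  i<[i∸j]+vⱼ : suc i ≤ (i ∸ j) + at v j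
  i<[i∸j]+vⱼ = ℕ.≤-trans i<vᵢ
    (subst (λ k → at v k ≤ (i ∸ j) + at v j) (ℕ.m∸n+n≡m j≤i) (Admissible-growth v a j (i ∸ j)))
  positive : ∀ x → suc i ≤ (i ∸ j) + x → 1 ≤ x
  positive zero i<i∸j+0 =
    contradiction (ℕ.≤-trans i<i∸j+0 (ℕ.≤-trans (ℕ.≤-reflexive (ℕ.+-identityʳ _)) (ℕ.m∸n≤m i j))) ℕ.1+n≰n
  positive (suc x) _ = s≤s z≤n

Admissible-from-∸ : {v m : Exp d} → m ≤ᵛ v → (∀ j → at m (suc j) ≤ at m j) →
  Admissible (v ∸ᵛ m) → Admissible v
Admissible-from-∸ {v = v} {m} m≤v m-antitone a j = begin
  at v (suc j)                                ≡⟨ restore (suc j) ⟨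
  at (v ∸ᵛ m) (suc j) + at m (suc j)          ≤⟨ ℕ.+-mono-≤ (a j) (m-antitone j) ⟩
  suc (at (v ∸ᵛ m) j + at m j)                ≡⟨ cong suc (restore j) ⟩
  suc (at v j)                                ∎
  where
  open ℕ.≤-Reasoning
  restore : ∀ j → at (v ∸ᵛ m) j + at m j ≡ at v j
  restore j = trans (cong (_+ at m j) (at-∸ᵛ v m j)) (ℕ.m∸n+n≡m (≤ᵛ⇒at≤ m≤v j))

Admissible-∸-prefix : (v : Exp d) → Admissible v → ∀ {i} → i < d → suc i ≤ at v i → at v (suc i) ≤ at v i →
  Admissible (v ∸ᵛ prefix d i)
Admissible-∸-prefix {d} v a {i} i<d i<vᵢ vᵢ₊₁≤vᵢ j =
  subst₂ (λ x y → x ≤ suc y) (sym (at-∸ᵛ v (prefix d i) (suc j))) (sym (at-∸ᵛ v (prefix d i) j)) step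
  where
  pred-mono : ∀ {x y} → x ≤ suc y → 1 ≤ y → x ∸ 1 ≤ suc (y ∸ 1)
  pred-mono {y = suc y} x≤1+y _ = ℕ.∸-monoˡ-≤ 1 x≤1+y
  ≤-suc-pred : ∀ {x y} → x ≤ y → 1 ≤ y → x ≤ suc (y ∸ 1)
  ≤-suc-pred {y = suc y} x≤y _ = x≤y
  step : at v (suc j) ∸ at (prefix d i) (suc j) ≤ suc (at v j ∸ at (prefix d i) j)
  step with ℕ.<-cmp j i
  ... | tri< j<i _ _ rewrite at-prefix-≤ d i (suc j) j<i i<d | at-prefix-≤ d i j (ℕ.<⇒≤ j<i) i<d =
    pred-mono (a j) (Admissible-positive v a i<vᵢ (ℕ.<⇒≤ j<i))
  ... | tri≈ _ refl _ rewrite at-prefix-> d j (suc j) (ℕ.n<1+n j) | at-prefix-≤ d j j ℕ.≤-refl i<d =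
    ≤-suc-pred vᵢ₊₁≤vᵢ (Admissible-positive v a i<vᵢ ℕ.≤-refl)
  ... | tri> _ _ i<j rewrite at-prefix-> d i (suc j) (ℕ.m<n⇒m<1+n i<j) | at-prefix-> d i j i<j = a j

prefix-≤ᵛ : (v : Exp d) → Admissible v → ∀ {i} → i < d → suc i ≤ at v i → prefix d i ≤ᵛ v
prefix-≤ᵛ {d} v a {i} i<d i<vᵢ = at≤⇒≤ᵛ (prefix d i) v below
  where
  below : ∀ j → at (prefix d i) j ≤ at v j
  below j with j ≤? i
  ... | yes j≤i = ℕ.≤-trans (ℕ.≤-reflexive (at-prefix-≤ d i j j≤i i<d)) (Admissible-positive v a i<vᵢ j≤i)
  ... | no j≰i = ℕ.≤-trans (ℕ.≤-reflexive (at-prefix-> d i j (ℕ.≰⇒> j≰i))) z≤n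

Admissible⇔prefix-∸ : (v : Exp d) {i : ℕ} → i < d → suc i ≤ at v i → at v (suc i) ≤ at v i →
  Admissible v ⇔ (prefix d i ≤ᵛ v × Admissible (v ∸ᵛ prefix d i))
Admissible⇔prefix-∸ {d} v {i} i<d i<vᵢ vᵢ₊₁≤vᵢ = mk⇔
  (λ a → prefix-≤ᵛ v a i<d i<vᵢ , Admissible-∸-prefix v a i<d i<vᵢ vᵢ₊₁≤vᵢ)
  (λ (P≤v , a) → Admissible-from-∸ P≤v (prefixExp-antitone d (suc i)) a)

A-shift-prefix : (v : Exp d) {i : ℕ} → i < d → suc i ≤ at v i → at v (suc i) ≤ at v i →
  A d v ≡ shift (prefix d i) (A d) v
A-shift-prefix {d} v {i} i<d i<vᵢ vᵢ₊₁≤vᵢ = begin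
  A d v
    ≡⟨ A-when v ⟩
  when (admissible? v) (+ 1)
    ≡⟨ when-⇔ (admissible? v) (pᵢ ≤ᵛ? v ×-dec admissible? (v ∸ᵛ pᵢ)) (Admissible⇔prefix-∸ v i<d i<vᵢ vᵢ₊₁≤vᵢ) ⟩
  when (pᵢ ≤ᵛ? v ×-dec admissible? (v ∸ᵛ pᵢ)) (+ 1)
    ≡⟨ when-× (pᵢ ≤ᵛ? v) (admissible? (v ∸ᵛ pᵢ)) ⟨
  when (pᵢ ≤ᵛ? v) (when (admissible? (v ∸ᵛ pᵢ)) (+ 1))
    ≡⟨ cong (when (pᵢ ≤ᵛ? v)) (A-when (v ∸ᵛ pᵢ)) ⟨
  shift pᵢ (A d) v ∎
  where
  open ≡-Reasoning
  pᵢ = prefix d i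

-- The coefficients of α

shift-prefix-invariant : (k c : Exp d) {i : ℕ} → i < d → d ≤ at k i → at k (suc i) ≤ at k i →
  at c i ≡ at c (suc i) → at c (suc i) ≤ d ∸ suc i →
  shift c (A d) k ≡ shift (prefix d i +ᵛ c) (A d) k
shift-prefix-invariant {d} k c {i} i<d d≤kᵢ kᵢ₊₁≤kᵢ cᵢ≡cᵢ₊₁ cᵢ₊₁≤d∸i₊₁ = begin
  when (c ≤ᵛ? k) (A d (k ∸ᵛ c))
    ≡⟨ cong (when (c ≤ᵛ? k)) (A-shift-prefix (k ∸ᵛ c) i<d i<vᵢ vᵢ₊₁≤vᵢ) ⟩
  when (c ≤ᵛ? k) (shift (prefix d i) (A d) (k ∸ᵛ c))
    ≡⟨ shift-+ᵛ c (prefix d i) (A d) k ⟨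
  shift (c +ᵛ prefix d i) (A d) k
    ≡⟨ cong (λ m → shift m (A d) k) (+ᵛ-comm c (prefix d i)) ⟩
  shift (prefix d i +ᵛ c) (A d) k ∎
  where
  open ≡-Reasoning
  i<vᵢ : suc i ≤ at (k ∸ᵛ c) i
  i<vᵢ = subst (suc i ≤_) (sym (at-∸ᵛ k c i))
    (subst (_≤ at k i ∸ at c i) (ℕ.m∸[m∸n]≡n i<d)
      (ℕ.∸-mono d≤kᵢ (subst (_≤ d ∸ suc i) (sym cᵢ≡cᵢ₊₁) cᵢ₊₁≤d∸i₊₁)))
  vᵢ₊₁≤vᵢ : at (k ∸ᵛ c) (suc i) ≤ at (k ∸ᵛ c) i
  vᵢ₊₁≤vᵢ = subst₂ _≤_ (sym (at-∸ᵛ k c (suc i))) (sym (at-∸ᵛ k c i))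
    (subst (λ t → at k (suc i) ∸ at c (suc i) ≤ at k i ∸ t) (sym cᵢ≡cᵢ₊₁) (ℕ.∸-monoˡ-≤ (at c (suc i)) kᵢ₊₁≤kᵢ))

otherPrefixes-agree : {i : ℕ} → i < d →
  ListAll.All (λ m → at m i ≡ at m (suc i)) (applyUpTo (prefix d) i ++ applyUpTo (λ t → prefix d (i + suc t)) (d ∸ suc i))
otherPrefixes-agree {d} {i} i<d = ListAll.++⁺
  (ListAll.applyUpTo⁺₁ (prefix d) i (λ {r} r<i →
    trans (at-prefix-> d r i r<i) (sym (at-prefix-> d r (suc i) (ℕ.m<n⇒m<1+n r<i)))))
  (ListAll.applyUpTo⁺₁ (λ t → prefix d (i + suc t)) (d ∸ suc i) (λ {t} t<d∸i₊₁ →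
    trans (at-prefix-≤ d (i + suc t) i (ℕ.m≤m+n i (suc t)) (r<d t<d∸i₊₁))
          (sym (at-prefix-≤ d (i + suc t) (suc i) i+1≤r (r<d t<d∸i₊₁)))))
  where
  r<d : ∀ {t} → t < d ∸ suc i → i + suc t < d
  r<d {t} t<d∸i₊₁ = subst (i + suc t <_) (trans (ℕ.+-suc i _) (ℕ.m+[n∸m]≡n i<d)) (ℕ.+-monoʳ-< i (s≤s t<d∸i₊₁))
  i+1≤r : ∀ {t} → suc i ≤ i + suc t
  i+1≤r {t} = subst (suc i ≤_) (sym (ℕ.+-suc i t)) (s≤s (ℕ.m≤m+n i t))

-- Toggling x₁⋯x_{i+1} does not change the summand, since no other prefix separates coordinates i and i+1.
coefficient-vanishes : (k : Exp d) {i : ℕ} → i < d → d ≤ at k i → at k (suc i) ≤ at k i →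
  signedSubsetSum (prefixes d) (λ c → shift c (A d) k) ≡ + 0
coefficient-vanishes {d} k {i} i<d d≤kᵢ kᵢ₊₁≤kᵢ =
  trans (cong (λ L → signedSubsetSum L F) split) (signedSubsetSum-cancel pre post (prefix d i) F invariant)
  where
  F : Exp d → ℤ
  F c = shift c (A d) k
  n = d ∸ suc i
  i+1+n≡d : i + suc n ≡ d
  i+1+n≡d = trans (ℕ.+-suc i n) (ℕ.m+[n∸m]≡n i<d)
  pre = applyUpTo (prefix d) i
  post = applyUpTo (λ t → prefix d (i + suc t)) n
  split : prefixes d ≡ pre ++ prefix d i ∷ post
  split = trans (cong (applyUpTo (prefix d)) (sym i+1+n≡d)) (applyUpTo-split (prefix d) i n)
  invariant : ∀ c → SubsetSum (pre ++ post) c → F c ≡ F (prefix d i +ᵛ c)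
  invariant c s = shift-prefix-invariant k c i<d d≤kᵢ kᵢ₊₁≤kᵢ
    (SubsetSum-at-≡ i (suc i) (otherPrefixes-agree i<d) s)
    (subst (at c (suc i) ≤_) (columnSum-prefixes d (suc i))
      (SubsetSum-at-≤ (subst (λ L → SubsetSum L c) (sym split) (SubsetSum-insert pre post (prefix d i) s)) (suc i)))

All≤⇒at≤ : ∀ {n b} {v : Vec ℕ n} → All (_≤ b) v → ∀ j → at v j ≤ b
All≤⇒at≤ [] j = z≤n
All≤⇒at≤ (x≤b ∷ _) zero = x≤b
All≤⇒at≤ (_ ∷ v≤b) (suc j) = All≤⇒at≤ v≤b j

bounded-or-descent : ∀ {n} (b : ℕ) (v : Vec ℕ n) →
  All (_≤ b) v ⊎ Σ ℕ (λ i → i < n × b < at v i × at v (suc i) ≤ at v i)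
bounded-or-descent b [] = inj₁ []
bounded-or-descent b (x ∷ v) with bounded-or-descent b v
... | inj₂ (i , i<n , b<vᵢ , vᵢ₊₁≤vᵢ) = inj₂ (suc i , s≤s i<n , b<vᵢ , vᵢ₊₁≤vᵢ)
... | inj₁ v≤b with x ≤? b
...   | yes x≤b = inj₁ (x≤b ∷ v≤b)
...   | no x≰b = inj₂ (0 , s≤s z≤n , ℕ.≰⇒> x≰b , ℕ.≤-trans (All≤⇒at≤ v≤b 0) (ℕ.<⇒≤ (ℕ.≰⇒> x≰b)))

A-0ᵛ : ∀ d → A d 0ᵛ ≡ + 1
A-0ᵛ zero = refl
A-0ᵛ (suc zero) = refl
A-0ᵛ (suc (suc d)) = A-0ᵛ (suc d)

constant-coefficient : ∀ d → signedSubsetSum (prefixes d) (λ c → shift c (A d) 0ᵛ) ≡ + 1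
constant-coefficient d =
  trans (signedSubsetSum-origin (prefixes d) (λ c → shift c (A d) 0ᵛ)
          (ListAll.applyUpTo⁺₁ (prefix d) d (λ {r} r<d c → when-no (_ ≤ᵛ? 0ᵛ) (not-≤0 r r<d c))))
        (trans (shift-0ᵛ (A d) 0ᵛ) (A-0ᵛ d))
  where
  not-≤0 : ∀ r → r < d → (c : Exp d) → ¬ (prefix d r +ᵛ c) ≤ᵛ 0ᵛ
  not-≤0 r r<d c m+c≤0 = ℕ.1+n≰n (begin
    1                              ≡⟨ at-prefix-≤ d r 0 z≤n r<d ⟨
    at (prefix d r) 0              ≤⟨ ℕ.m≤m+n _ (at c 0) ⟩
    at (prefix d r) 0 + at c 0     ≡⟨ at-+ᵛ (prefix d r) c 0 ⟨
    at (prefix d r +ᵛ c) 0         ≤⟨ ≤ᵛ⇒at≤ m+c≤0 0 ⟩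
    at (replicate d 0) 0           ≡⟨ at-0ᵛ d 0 ⟩
    0                              ∎)
    where open ℕ.≤-Reasoning

columnSum-heads : (L : List (Exp d)) → ListAll.All (λ m → at m 0 ≡ 1) L → columnSum L 0 ≡ List.length L
columnSum-heads [] [] = refl
columnSum-heads (m ∷ L) (m₀≡1 ∷ ms) = cong₂ _+_ m₀≡1 (columnSum-heads L ms)

signedSubsetSum-full : (L : List (Exp d)) → ListAll.All (λ m → at m 0 ≡ 1) L →
  signedSubsetSum L (λ c → when (at c 0 ≟ List.length L) (+ 1)) ≡ (- + 1) ^ List.length L
signedSubsetSum-full {d} [] [] = when-yes (at (replicate d 0) 0 ≟ 0) (at-0ᵛ d 0)
signedSubsetSum-full (m ∷ L) (m₀≡1 ∷ ms) = begin
  signedSubsetSum L (λ c → when (at c 0 ≟ suc n) (+ 1))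
    -ᶻ signedSubsetSum L (λ c → when (at (m +ᵛ c) 0 ≟ suc n) (+ 1))
    ≡⟨ cong₂ _-ᶻ_ (trans (signedSubsetSum-cong L too-large) (signedSubsetSum-zero L))
                  (signedSubsetSum-cong L (λ c _ → when-⇔ (at (m +ᵛ c) 0 ≟ suc n) (at c 0 ≟ n) (shifted c))) ⟩
  + 0 -ᶻ signedSubsetSum L (λ c → when (at c 0 ≟ n) (+ 1))
    ≡⟨ cong (+ 0 -ᶻ_) (signedSubsetSum-full L ms) ⟩
  + 0 -ᶻ (- + 1) ^ n
    ≡⟨ negate ((- + 1) ^ n) ⟩
  (- + 1) ^ suc n ∎
  where
  open ≡-Reasoning
  n = List.length L
  too-large : ∀ c → SubsetSum L c → when (at c 0 ≟ suc n) (+ 1) ≡ + 0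
  too-large c s = when-no (at c 0 ≟ suc n) λ c₀≡1+n →
    ℕ.1+n≰n (subst₂ _≤_ c₀≡1+n (columnSum-heads L ms) (SubsetSum-at-≤ s 0))
  shifted : ∀ c → (at (m +ᵛ c) 0 ≡ suc n) ⇔ (at c 0 ≡ n)
  shifted c rewrite at-+ᵛ m c 0 | m₀≡1 = mk⇔ ℕ.suc-injective (cong suc)
  negate : ∀ x → + 0 -ᶻ x ≡ (- + 1) *ᶻ x
  negate = solve-∀

SubsetSum-prefixes-≤ : {c : Exp d} → SubsetSum (prefixes d) c → ∀ j → at c j ≤ d ∸ j
SubsetSum-prefixes-≤ {d} {c} s j = subst (at c j ≤_) (columnSum-prefixes d j) (SubsetSum-at-≤ s j)

SubsetSum-prefixes-step : {c : Exp d} → SubsetSum (prefixes d) c → ∀ j → suc j < d → at c j ≤ suc (at c (suc j))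
SubsetSum-prefixes-step {d} {c} s j j+1<d = ℕ.+-cancelʳ-≤ (d ∸ suc j) (at c j) (suc (at c (suc j))) (begin
  at c j + (d ∸ suc j)                   ≡⟨ cong (λ t → at c j + t) (columnSum-prefixes d (suc j)) ⟨
  at c j + columnSum (prefixes d) (suc j) ≤⟨ SubsetSum-step j antitone s ⟩
  at c (suc j) + columnSum (prefixes d) j ≡⟨ cong (λ t → at c (suc j) + t) (columnSum-prefixes d j) ⟩
  at c (suc j) + (d ∸ j)                 ≡⟨ cong (λ t → at c (suc j) + t) (ℕ.+-∸-assoc 1 (ℕ.<⇒≤ j+1<d)) ⟩
  at c (suc j) + suc (d ∸ suc j)         ≡⟨ ℕ.+-suc (at c (suc j)) _ ⟩
  suc (at c (suc j)) + (d ∸ suc j)       ∎)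
  where
  open ℕ.≤-Reasoning
  antitone : ListAll.All (λ m → at m (suc j) ≤ at m j) (prefixes d)
  antitone = ListAll.applyUpTo⁺₂ (prefix d) d (λ r → prefixExp-antitone d (suc r) j)

∸-suc-antitone : ∀ b {x y} → x ≤ suc y → b ∸ y ≤ suc (b ∸ x)
∸-suc-antitone b {zero} {y} _ = ℕ.≤-trans (ℕ.m∸n≤m b y) (ℕ.n≤1+n b)
∸-suc-antitone zero {suc x} {y} _ = ℕ.≤-trans (ℕ.≤-reflexive (ℕ.0∸n≡0 y)) z≤n
∸-suc-antitone (suc b) {suc zero} {zero} _ = ℕ.≤-refl
∸-suc-antitone (suc b) {suc (suc x)} {zero} (s≤s ())
∸-suc-antitone (suc b) {suc x} {suc y} x≤1+y = ∸-suc-antitone b (ℕ.s≤s⁻¹ x≤1+y)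

replicate-∸ᵛ-Admissible : ∀ b (c : Exp d) → (∀ j → suc j < d → at c j ≤ suc (at c (suc j))) →
  Admissible (replicate d b ∸ᵛ c)
replicate-∸ᵛ-Admissible {d} b c step j with suc j ℕ.<? d
... | yes j+1<d = subst₂ (λ x y → x ≤ suc y)
        (sym (trans (at-∸ᵛ (replicate d b) c (suc j)) (cong (_∸ at c (suc j)) (at-replicate d b (suc j) j+1<d))))
        (sym (trans (at-∸ᵛ (replicate d b) c j) (cong (_∸ at c j) (at-replicate d b j (ℕ.<-trans (ℕ.n<1+n j) j+1<d)))))
        (∸-suc-antitone b (step j j+1<d))
... | no j+1≮d = ℕ.≤-trans (ℕ.≤-reflexive (at-≥ (replicate d b ∸ᵛ c) (suc j) (ℕ.≮⇒≥ j+1≮d))) z≤n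

≤ᵛ-replicate : ∀ {n b} (u : Vec ℕ n) → (∀ j → at u j ≤ b) → u ≤ᵛ replicate n b
≤ᵛ-replicate [] _ = []
≤ᵛ-replicate (x ∷ u) u≤b = u≤b 0 ∷ ≤ᵛ-replicate u (u≤b ∘ suc)

when-≤-as-complement : ∀ {x n} → x ≤ suc n → when (x ≤? n) (+ 1) ≡ + 1 -ᶻ when (x ≟ suc n) (+ 1)
when-≤-as-complement {x} {n} x≤1+n = complement (x ≤? n)
  where
  complement : (x≤?n : Dec (x ≤ n)) → when x≤?n (+ 1) ≡ + 1 -ᶻ when (x ≟ suc n) (+ 1)
  complement (yes x≤n) = sym (cong (+ 1 -ᶻ_) (when-no (x ≟ suc n) λ x≡1+n → ℕ.1+n≰n (subst (_≤ n) x≡1+n x≤n)))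
  complement (no x≰n) = sym (cong (+ 1 -ᶻ_) (when-yes (x ≟ suc n) (ℕ.≤-antisym x≤1+n (ℕ.≰⇒> x≰n))))

top-coefficient : ∀ d → 1 ≤ d →
  signedSubsetSum (prefixes d) (λ c → shift c (A d) (replicate d (d ∸ 1))) ≡ (- + 1) ^ (d ∸ 1)
top-coefficient d@(suc d′) _ = begin
  signedSubsetSum ps (λ c → shift c (A d) k)
    ≡⟨ signedSubsetSum-cong ps summand ⟩
  signedSubsetSum ps (λ c → + 1 -ᶻ when (at c 0 ≟ d) (+ 1))
    ≡⟨ signedSubsetSum-- ps (λ _ → + 1) (λ c → when (at c 0 ≟ d) (+ 1)) ⟩
  signedSubsetSum ps (λ _ → + 1) -ᶻ signedSubsetSum ps (λ c → when (at c 0 ≟ d) (+ 1))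
    ≡⟨ cong₂ _-ᶻ_ (signedSubsetSum-const (prefix d 0) (applyUpTo (prefix d ∘ suc) d′) (+ 1)) full ⟩
  + 0 -ᶻ (- + 1) *ᶻ (- + 1) ^ d′
    ≡⟨ negate-negate ((- + 1) ^ d′) ⟩
  (- + 1) ^ d′ ∎
  where
  open ≡-Reasoning
  k = replicate d d′
  ps = prefixes d
  full : signedSubsetSum ps (λ c → when (at c 0 ≟ d) (+ 1)) ≡ (- + 1) ^ d
  full = subst (λ n → signedSubsetSum ps (λ c → when (at c 0 ≟ n) (+ 1)) ≡ (- + 1) ^ n)
    (List.length-applyUpTo (prefix d) d)
    (signedSubsetSum-full ps (ListAll.applyUpTo⁺₁ (prefix d) d (at-prefix-≤ d _ 0 z≤n)))
  summand : ∀ c → SubsetSum ps c → shift c (A d) k ≡ + 1 -ᶻ when (at c 0 ≟ d) (+ 1)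
  summand c@(c₀ ∷ cs) s = begin
    when (c ≤ᵛ? k) (A d (k ∸ᵛ c))
      ≡⟨ cong (when (c ≤ᵛ? k)) (trans (A-when (k ∸ᵛ c)) (when-yes (admissible? (k ∸ᵛ c))
           (replicate-∸ᵛ-Admissible d′ c (SubsetSum-prefixes-step s)))) ⟩
    when (c ≤ᵛ? k) (+ 1)
      ≡⟨ when-⇔ (c ≤ᵛ? k) (c₀ ≤? d′) (mk⇔ Pointwise.head (λ c₀≤d′ → c₀≤d′ ∷ ≤ᵛ-replicate cs tail≤d′)) ⟩
    when (c₀ ≤? d′) (+ 1)
      ≡⟨ when-≤-as-complement (SubsetSum-prefixes-≤ s 0) ⟩
    + 1 -ᶻ when (c₀ ≟ d) (+ 1) ∎
    where
    tail≤d′ : ∀ j → at cs j ≤ d′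
    tail≤d′ j = ℕ.≤-trans (SubsetSum-prefixes-≤ s (suc j)) (ℕ.m∸n≤m d′ j)
  negate-negate : ∀ x → + 0 -ᶻ (- + 1) *ᶻ x ≡ x
  negate-negate = solve-∀

-1^n≢0 : ∀ n → (- + 1) ^ n ≢ + 0
-1^n≢0 zero ()
-1^n≢0 (suc n) -1*-1^n≡0 with ℤ.i*j≡0⇒i≡0∨j≡0 (- + 1) -1*-1^n≡0
... | inj₂ -1^n≡0 = -1^n≢0 n -1^n≡0

lemma3 : (d : ℕ) → 1 ≤ d →
    Σ (FPS d) λ α →
      ((e : Exp d) → α e ≢ + 0 → All (_≤ d ∸ 1) e)
      × ((i : Fin d) → Σ (Exp d) λ e → (α e ≢ + 0) × (lookup e i ≡ d ∸ 1))
      × (A d ⋆ denom d) ≐ α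
      × (α (replicate d 0) ≡ + 1)
      × (α (replicate d (d ∸ 1)) ≡ (- + 1) ^ (d ∸ 1))
lemma3 d@(suc d′) _ = α , bounded , top-in-every-variable , (λ _ → refl) , α-0 , α-top
  where
  α : FPS d
  α = A d ⋆ denom d
  expansion : ∀ k → α k ≡ signedSubsetSum (prefixes d) (λ c → shift c (A d) k)
  expansion k = trans (cong (λ D → (A d ⋆ D) k) (denom-prefixes d)) (⋆-∏[1-xᵐ] (A d) (prefixes d) k)
  α-0 : α (replicate d 0) ≡ + 1
  α-0 = trans (expansion _) (constant-coefficient d)
  α-top : α (replicate d d′) ≡ (- + 1) ^ d′
  α-top = trans (expansion _) (top-coefficient d (s≤s z≤n))
  bounded : (e : Exp d) → α e ≢ + 0 → All (_≤ d′) e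
  bounded e αₑ≢0 with bounded-or-descent d′ e
  ... | inj₁ e≤d′ = e≤d′
  ... | inj₂ (i , i<d , d≤eᵢ , eᵢ₊₁≤eᵢ) =
    contradiction (trans (expansion e) (coefficient-vanishes e i<d d≤eᵢ eᵢ₊₁≤eᵢ)) αₑ≢0
  top-in-every-variable : (i : Fin d) → Σ (Exp d) λ e → (α e ≢ + 0) × (lookup e i ≡ d′)
  top-in-every-variable i = replicate d d′ , -1^n≢0 d′ ∘ trans (sym α-top) , lookup-replicate i d′
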